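{- Let $P$ be a polyhedron. All circuit walks in $P$ are reversible if and only if all circuit walks in $P$ are vertex walks.
   Context: For a polyhedron $P=\{x\in\mathbb R^n: Ax=b,\ Bx\le d\}$ with rational matrices $A,B$, the set of circuits $\mathcal C(A,B)$ consists of all $g\in\ker(A)\setminus\{0\}$ with coprime integer components such that the support of $Bg$ is inclusion-minimal among the supports of the vectors $Bx$, $x\in\ker(A)\setminus\{0\}$ (note $\mathcal C(A,B)=-\mathcal C(A,B)$). For vertices $v^{(1)},v^{(2)}$ of $P$, a circuit walk of length $k$ is a sequence $v^{(1)}=y^{(0)},\dots,y^{(k)}=v^{(2)}$ such that for $i=0,\dots,k-1$: $y^{(i)}\in P$; $y^{(i+1)}=y^{(i)}+\alpha_i g^{(i)}$ for some $g^{(i)}\in\mathcal C(A,B)$ and $\alpha_i>0$; and $y^{(i)}+\alpha g^{(i)}\notin P$ for all $\alpha>\alpha_i$ (maximal steps). A circuit walk is a vertex walk if every $y^{(i)}$ is a vertex of $P$. A circuit walk $y^{(0)},\dots,y^{(k)}$ is reversible if the reversed sequence $y^{(k)},y^{(k-1)},\dots,y^{(0)}$ is also a circuit walk in $P$. -}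

module Defs where

open import Data.Nat using (ℕ; zero; suc)
open import Data.Nat.Divisibility using (_∣_)
open import Data.Integer using (ℤ; +_; ∣_∣)
open import Data.Rational using (ℚ; 0ℚ; 1ℚ; _+_; _*_; _-_; _≤_; _<_; _/_)
open import Data.Fin using (Fin; zero; suc; inject₁; fromℕ; opposite)
open import Data.Vec.Functional using (Vector; foldr)
open import Data.Product using (Σ; ∃; _×_)
open import Relation.Binary.PropositionalEquality using (_≡_; _≢_)
open import Relation.Nullary using (¬_)

Pt : ℕ → Set
Pt n = Fin n → ℚ

Mat : ℕ → ℕ → Set
Mat m n = Fin m → Fin n → ℚ

dot : ∀ {n} → Pt n → Pt n → ℚ
dot x y = foldr _+_ 0ℚ (λ j → x j * y j)

mul : ∀ {m n} → Mat m n → Pt n → Pt m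
mul M x i = dot (M i) x

addScaled : ∀ {n} → Pt n → ℚ → Pt n → Pt n
addScaled x α g j = x j + α * g j

ofℤ : ∀ {n} → (Fin n → ℤ) → Pt n
ofℤ g j = g j / 1

record Polyhedron (n : ℕ) : Set where
  field
    m₁ m₂ : ℕ
    A : Mat m₁ n
    b : Pt m₁
    B : Mat m₂ n
    d : Pt m₂

module _ {n : ℕ} (P : Polyhedron n) where
  open Polyhedron P

  _∈P : Pt n → Set
  x ∈P = (∀ i → mul A x i ≡ b i) × (∀ i → mul B x i ≤ d i)

  IsVertex : Pt n → Set
  IsVertex x = x ∈P ×
    (∀ (e : Pt n) → addScaled x 1ℚ e ∈P → addScaled x (0ℚ - 1ℚ) e ∈P → ∀ j → e j ≡ 0ℚ)

  InKerA : Pt n → Set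
  InKerA x = ∀ i → mul A x i ≡ 0ℚ

  NonZeroPt : Pt n → Set
  NonZeroPt x = ∃ λ j → x j ≢ 0ℚ

  SuppStrictSub : Pt n → Pt n → Set
  SuppStrictSub x y =
    (∀ i → mul B x i ≢ 0ℚ → mul B y i ≢ 0ℚ) ×
    (∃ λ i → (mul B y i ≢ 0ℚ) × (mul B x i ≡ 0ℚ))

  Coprime : (Fin n → ℤ) → Set
  Coprime g = ∀ (k : ℕ) → (∀ j → k ∣ ∣ g j ∣) → k ≡ 1

  IsCircuit : (Fin n → ℤ) → Set
  IsCircuit g =
    InKerA (ofℤ g) × NonZeroPt (ofℤ g) × Coprime g ×
    (¬ (∃ λ x → InKerA x × NonZeroPt x × SuppStrictSub x (ofℤ g)))

  CircuitStep : Pt n → Pt n → Set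
  CircuitStep x x' = x ∈P × Σ (Fin n → ℤ) λ g → IsCircuit g × Σ ℚ λ α →
    (0ℚ < α) × (∀ j → x' j ≡ addScaled x α (ofℤ g) j) ×
    (∀ β → α < β → ¬ (addScaled x β (ofℤ g) ∈P))

  IsCircuitWalk : (k : ℕ) → (Fin (suc k) → Pt n) → Set
  IsCircuitWalk k y = IsVertex (y zero) × IsVertex (y (fromℕ k)) ×
    (∀ (i : Fin k) → CircuitStep (y (inject₁ i)) (y (suc i)))

  IsVertexWalk : (k : ℕ) → (Fin (suc k) → Pt n) → Set
  IsVertexWalk k y = IsCircuitWalk k y × (∀ i → IsVertex (y i))

  IsReversible : (k : ℕ) → (Fin (suc k) → Pt n) → Set
  IsReversible k y = IsCircuitWalk k y × IsCircuitWalk k (λ i → y (opposite i))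

  AllWalksReversible : Set
  AllWalksReversible = ∀ k y → IsCircuitWalk k y → IsReversible k y

  AllWalksVertexWalks : Set
  AllWalksVertexWalks = ∀ k y → IsCircuitWalk k y → IsVertexWalk k y

-- A circuit step from a vertex x to y can always be reversed: from y, the step along −g of the
-- same length is maximal, since a longer one would put x strictly inside a segment of P.
-- Hence if all circuit walks are vertex walks, all of them are reversible.
--
-- Conversely, let y ± e ∈ P (e ≠ 0) for a point y of a circuit walk starting at the vertex v.
-- Scaling a kernel vector of minimal B-support below that of e to a primitive integer vector
-- gives a circuit g which keeps the constraints tight at y tight. A maximal step along ±g
-- then reaches a point with strictly fewer non-tight constraints, while y ∓ εg ∈ P for small
-- ε > 0; repeating, we descend to a vertex. Together with the walk from v to y this is a
-- circuit walk, but in its reverse the step back into y could be prolonged past y, so it is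
-- not maximal. Minimal supports and the vertex test are classical; the argument runs in the
-- double-negation monad, which suffices because the conclusion (e = 0) is decidable.

module Submission where

open import Defs
open import Level using (0ℓ)
open import Data.Nat as ℕ using (ℕ; zero; suc)
import Data.Nat.Properties as ℕ
import Data.Nat.Divisibility as ℕ
open import Data.Nat.GCD using (gcd; gcd[m,n]∣m; gcd[m,n]∣n; gcd-greatest)
import Data.Nat.Coprimality as ℕ using (sym; 1-coprimeTo)
open import Data.Integer as ℤ using (ℤ; +_; -[1+_]; sign; _◃_)
import Data.Integer.Properties as ℤ
import Data.Sign as Sign
import Data.Sign.Properties as Sign
open import Data.Fin using (Fin; zero; suc; inject₁; fromℕ; opposite)
open import Data.Fin.Properties using (any?; opposite-involutive; ¬∀⟶∃¬)
open import Data.Fin.Subset using (Subset; inside; outside; _∈_; ∣_∣)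
open import Data.Fin.Subset.Properties using (p⊂q⇒∣p∣<∣q∣)
open import Data.Vec using (tabulate)
open import Data.Vec.Properties using (lookup∘tabulate; []=⇒lookup; lookup⇒[]=)
open import Data.Rational using (ℚ; mkℚ; 0ℚ; 1ℚ; _+_; _*_; _-_; -_; _⊓_; _≤_; _<_; _/_; 1/_; ↥_; ↧_; ↧ₙ_; positive; nonNegative; nonPositive; ≢-nonZero)
open import Data.Rational.Properties
import Data.Rational.Unnormalised as ℚᵘ
import Data.Rational.Unnormalised.Properties as ℚᵘ
open import Data.Rational.Solver using (module +-*-Solver)
open import Data.Product using (∃; ∃₂; _×_; _,_; proj₁; proj₂)
open import Data.Sum using (_⊎_; inj₁; inj₂)
open import Data.Empty using (⊥; ⊥-elim)
open import Data.Bool using (if_then_else_)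
open import Function using (_∘_; flip; id)
open import Function.Bundles using (_⇔_; mk⇔; Equivalence)
open import Effect.Monad using (RawMonad)
open import Relation.Unary using (Decidable)
open import Relation.Nullary using (¬_; yes; no; does; contradiction)
open import Relation.Nullary.Decidable using (decidable-stable; ¬¬-excluded-middle)
open import Relation.Nullary.Negation using (¬¬-Monad)
open import Relation.Binary.Definitions using (tri<; tri≈; tri>)
open import Relation.Binary.PropositionalEquality
open import Relation.Binary.Construct.Closure.ReflexiveTransitive using (Star; _◅_; _◅◅_) renaming (ε to done)

open +-*-Solver

private
  variable
    p q r s t : ℚ

p+q≤r⇒q≤r-p : p + q ≤ r → q ≤ r - p
p+q≤r⇒q≤r-p {p} {q} {r} h =
  subst (_≤ r - p) (solve 2 (λ p q → (p :+ q) :- p := q) refl p q) (+-monoˡ-≤ (- p) h)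

q≤r-p⇒p+q≤r : q ≤ r - p → p + q ≤ r
q≤r-p⇒p+q≤r {q} {r} {p} h =
  subst (p + q ≤_) (solve 2 (λ p r → p :+ (r :- p) := r) refl p r) (+-monoʳ-≤ p h)

p<q⇒0<q-p : p < q → 0ℚ < q - p
p<q⇒0<q-p {p} {q} h = subst (_< q - p) (+-inverseʳ p) (+-monoˡ-< (- p) h)

≤∧≢⇒< : p ≤ q → p ≢ q → p < q
≤∧≢⇒< {p} {q} p≤q p≢q with <-cmp p q
... | tri< p<q _ _ = p<q
... | tri≈ _ p≡q _ = contradiction p≡q p≢q
... | tri> _ _ q<p = ⊥-elim (<-irrefl refl (<-≤-trans q<p p≤q))

>⇒≢ : 0ℚ < p → p ≢ 0ℚ
>⇒≢ 0<p p≡0 = <-irrefl (sym p≡0) 0<p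

*-pos : 0ℚ < p → 0ℚ < q → 0ℚ < p * q
*-pos {p} {q} 0<p 0<q = positive⁻¹ _ {{pos*pos⇒pos p {{positive 0<p}} q {{positive 0<q}}}}

*-nonNeg-nonPos : 0ℚ ≤ p → q ≤ 0ℚ → p * q ≤ 0ℚ
*-nonNeg-nonPos {p} {q} 0≤p q≤0 =
  nonPositive⁻¹ _ {{nonNeg*nonPos⇒nonPos p {{nonNegative 0≤p}} q {{nonPositive q≤0}}}}

*-cancelˡ-≡0 : p ≢ 0ℚ → p * q ≡ 0ℚ → q ≡ 0ℚ
*-cancelˡ-≡0 {p} {q} p≢0 pq≡0 = begin
  q                 ≡⟨ sym (*-identityˡ q) ⟩
  1ℚ * q            ≡⟨ cong (_* q) (sym (*-inverseˡ p)) ⟩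
  (1/ p) * p * q    ≡⟨ *-assoc (1/ p) p q ⟩
  (1/ p) * (p * q)  ≡⟨ cong ((1/ p) *_) pq≡0 ⟩
  (1/ p) * 0ℚ       ≡⟨ *-zeroʳ (1/ p) ⟩
  0ℚ                ∎
  where
  open ≡-Reasoning
  instance
    _ = ≢-nonZero p≢0

scale : ∀ {m} → ℚ → Pt m → Pt m
scale c x j = c * x j

dot-cong : ∀ {m} (u : Pt m) {x y : Pt m} → (∀ j → x j ≡ y j) → dot u x ≡ dot u y
dot-cong {zero}  u x≗y = refl
dot-cong {suc m} u x≗y =
  cong₂ _+_ (cong (u zero *_) (x≗y zero)) (dot-cong (u ∘ suc) (x≗y ∘ suc))

dot-addScaled : ∀ {m} (u x g : Pt m) α → dot u (addScaled x α g) ≡ dot u x + α * dot u g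
dot-addScaled {zero}  u x g α = sym (trans (+-identityˡ (α * 0ℚ)) (*-zeroʳ α))
dot-addScaled {suc m} u x g α = begin
  u₀ * (x₀ + α * g₀) + dot (u ∘ suc) (addScaled (x ∘ suc) α (g ∘ suc))
    ≡⟨ cong (λ z → u₀ * (x₀ + α * g₀) + z) (dot-addScaled (u ∘ suc) (x ∘ suc) (g ∘ suc) α) ⟩
  u₀ * (x₀ + α * g₀) + (dot (u ∘ suc) (x ∘ suc) + α * dot (u ∘ suc) (g ∘ suc))
    ≡⟨ solve 6 (λ u₀ x₀ g₀ α X G → u₀ :* (x₀ :+ α :* g₀) :+ (X :+ α :* G)
                                 := (u₀ :* x₀ :+ X) :+ α :* (u₀ :* g₀ :+ G))
               refl u₀ x₀ g₀ α (dot (u ∘ suc) (x ∘ suc)) (dot (u ∘ suc) (g ∘ suc)) ⟩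
  dot u x + α * dot u g ∎
  where
  open ≡-Reasoning
  u₀ = u zero
  x₀ = x zero
  g₀ = g zero

dot-scale : ∀ {m} (u x : Pt m) c → dot u (scale c x) ≡ c * dot u x
dot-scale {zero}  u x c = sym (*-zeroʳ c)
dot-scale {suc m} u x c = begin
  u zero * (c * x zero) + dot (u ∘ suc) (scale c (x ∘ suc))
    ≡⟨ cong (λ z → u zero * (c * x zero) + z) (dot-scale (u ∘ suc) (x ∘ suc) c) ⟩
  u zero * (c * x zero) + c * dot (u ∘ suc) (x ∘ suc)
    ≡⟨ solve 4 (λ u₀ x₀ c X → u₀ :* (c :* x₀) :+ c :* X := c :* (u₀ :* x₀ :+ X))
               refl (u zero) (x zero) c (dot (u ∘ suc) (x ∘ suc)) ⟩
  c * dot u x ∎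
  where open ≡-Reasoning

-ᵛ_ : ∀ {m} → Pt m → Pt m
(-ᵛ u) j = - u j

dot-negate : ∀ {m} (w u : Pt m) → dot w (-ᵛ u) ≡ - dot w u
dot-negate w u = begin
  dot w (-ᵛ u)           ≡⟨ dot-cong w (λ j → solve 1 (λ a → :- a := (:- con 1ℚ) :* a) refl (u j)) ⟩
  dot w (scale (- 1ℚ) u) ≡⟨ dot-scale w u (- 1ℚ) ⟩
  - 1ℚ * dot w u         ≡⟨ solve 1 (λ a → (:- con 1ℚ) :* a := :- a) refl (dot w u) ⟩
  - dot w u              ∎
  where open ≡-Reasoning

scale-≢0 : p ≢ 0ℚ → (p * q ≢ 0ℚ) ⇔ (q ≢ 0ℚ)
scale-≢0 {p} {q} p≢0 = mk⇔ (λ pq≢0 q≡0 → pq≢0 (trans (cong (p *_) q≡0) (*-zeroʳ p)))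
                            (λ q≢0 pq≡0 → q≢0 (*-cancelˡ-≡0 p≢0 pq≡0))

support : ∀ {m} → (Fin m → ℚ) → Subset m
support f = tabulate λ i → if does (f i ≟ 0ℚ) then outside else inside

∈-support : ∀ {m} (f : Fin m → ℚ) {i} → i ∈ support f ⇔ f i ≢ 0ℚ
∈-support f {i} = mk⇔ (nonzero ∘ trans (sym (lookup∘tabulate _ i)) ∘ []=⇒lookup)
                           (lookup⇒[]= i _ ∘ trans (lookup∘tabulate _ i) ∘ inside-if-nonzero)
  where
  nonzero : (if does (f i ≟ 0ℚ) then outside else inside) ≡ inside → f i ≢ 0ℚ
  nonzero eq with f i ≟ 0ℚ
  nonzero () | yes _
  ...        | no fᵢ≢0 = fᵢ≢0
  inside-if-nonzero : f i ≢ 0ℚ → (if does (f i ≟ 0ℚ) then outside else inside) ≡ inside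
  inside-if-nonzero fᵢ≢0 with f i ≟ 0ℚ
  ... | yes fᵢ≡0 = contradiction fᵢ≡0 fᵢ≢0
  ... | no _     = refl

_⊆ˢ_ : ∀ {m} → (Fin m → ℚ) → (Fin m → ℚ) → Set
f ⊆ˢ g = ∀ i → f i ≢ 0ℚ → g i ≢ 0ℚ

⊆ˢ-trans : ∀ {m} {f g h : Fin m → ℚ} → f ⊆ˢ g → g ⊆ˢ h → f ⊆ˢ h
⊆ˢ-trans f⊆g g⊆h i = g⊆h i ∘ f⊆g i

mul-rescale : ∀ {m k} (M : Mat m k) {x : Pt k} p y → (∀ j → x j ≡ p * y j) → ∀ i → mul M x i ≡ p * mul M y i
mul-rescale M p y x≡py i = trans (dot-cong (M i) x≡py) (dot-scale (M i) y p)

rescale-⊆ˢ : ∀ {m k} (M : Mat m k) {x : Pt k} p y → p ≢ 0ℚ → (∀ j → x j ≡ p * y j) → mul M y ⊆ˢ mul M x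
rescale-⊆ˢ M p y p≢0 x≡py i Myᵢ≢0 =
  subst (_≢ 0ℚ) (sym (mul-rescale M p y x≡py i)) (Equivalence.from (scale-≢0 p≢0) Myᵢ≢0)

∣support∣-< : ∀ {m} {f g : Fin m → ℚ} → f ⊆ˢ g → (∃ λ i → g i ≢ 0ℚ × f i ≡ 0ℚ) →
              ∣ support f ∣ ℕ.< ∣ support g ∣
∣support∣-< {f = f} {g} f⊆g (i , gᵢ≢0 , fᵢ≡0) = p⊂q⇒∣p∣<∣q∣
  ( (λ j∈f → from (∈-support g) (f⊆g _ (to (∈-support f) j∈f)))
  , i , from (∈-support g) gᵢ≢0 , (λ i∈f → to (∈-support f) i∈f fᵢ≡0) )
  where open Equivalence

open RawMonad (¬¬-Monad {a = 0ℓ}) using (_>>=_; return)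

¬¬-minimal : {A : Set} (Q : A → Set) (μ : A → ℕ) {x : A} → Q x →
             ¬ ¬ (∃ λ y → Q y × ∀ z → Q z → μ y ℕ.≤ μ z)
¬¬-minimal Q μ {x} qx = below (suc (μ x)) x qx ℕ.≤-refl
  where
  Minimal = ∃ λ y → Q y × ∀ z → Q z → μ y ℕ.≤ μ z
  below : ∀ N x → Q x → μ x ℕ.< N → ¬ ¬ Minimal
  below (suc N) x qx μx<1+N = ¬¬-excluded-middle >>= λ where
    (no none) → return (x , qx , λ z qz → ℕ.≮⇒≥ (λ μz<μx → none (z , qz , μz<μx)))
    (yes (z , qz , μz<μx)) → below N z qz (ℕ.<-≤-trans μz<μx (ℕ.≤-pred μx<1+N))

argmin : ∀ {m} {S : Fin m → Set} → Decidable S → (f : ∀ r → .(S r) → ℚ) →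
         (∀ r → ¬ S r) ⊎ ∃₂ λ r (s : S r) → ∀ r′ (s′ : S r′) → f r s ≤ f r′ s′
argmin {zero}  S? f = inj₁ λ ()
argmin {suc m} S? f with argmin (S? ∘ suc) (f ∘ suc) | S? zero
... | inj₁ none | no ¬s₀ = inj₁ λ { zero s₀ → ¬s₀ s₀ ; (suc r) s → none r s }
... | inj₁ none | yes s₀ = inj₂ (zero , s₀ , λ { zero _ → ≤-refl ; (suc r) s → contradiction s (none r) })
... | inj₂ (r , s , min) | no ¬s₀ = inj₂ (suc r , s , λ { zero s₀ → contradiction s₀ ¬s₀ ; (suc r′) s′ → min r′ s′ })
... | inj₂ (r , s , min) | yes s₀ with f zero s₀ ≤? f (suc r) s
...   | yes f₀≤ = inj₂ (zero , s₀ , λ { zero _ → ≤-refl ; (suc r′) s′ → ≤-trans f₀≤ (min r′ s′) })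
...   | no f₀≰ = inj₂ (suc r , s , λ { zero _ → <⇒≤ (≰⇒> f₀≰) ; (suc r′) s′ → min r′ s′ })

-- The same rational as `i / 1` (see /1≡fromℤ), but built without normalising, so that
-- `fromℤ i * fromℤ j` computes to `(i ℤ.* j) / 1`.
fromℤ : ℤ → ℚ
fromℤ i = mkℚ i 0 (ℕ.sym (ℕ.1-coprimeTo ℤ.∣ i ∣))

/1≡fromℤ : ∀ i → i / 1 ≡ fromℤ i
/1≡fromℤ (+ n)    = normalize-coprime (ℕ.sym (ℕ.1-coprimeTo n))
/1≡fromℤ -[1+ n ] = cong -_ (normalize-coprime (ℕ.sym (ℕ.1-coprimeTo (suc n))))

fromℤ-* : ∀ i j → fromℤ i * fromℤ j ≡ fromℤ (i ℤ.* j)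
fromℤ-* i j = /1≡fromℤ (i ℤ.* j)

fromℤ-pos : ∀ {m} → 0 ℕ.< m → 0ℚ < fromℤ (+ m)
fromℤ-pos {suc m} _ = positive⁻¹ _

↧*≡↥ : ∀ q → fromℤ (↧ q) * q ≡ fromℤ (↥ q)
↧*≡↥ q@(mkℚ i d-1 _) = toℚᵘ-injective (ℚᵘ.≃-trans (toℚᵘ-homo-* (fromℤ (↧ q)) q) (ℚᵘ.*≡* cross))
  where
  cross : (↧ q ℤ.* i) ℤ.* + 1 ≡ i ℤ.* (+ suc (d-1 ℕ.+ 0))
  cross rewrite ℕ.+-identityʳ d-1 = trans (ℤ.*-identityʳ _) (ℤ.*-comm (↧ q) i)

clear-denominators : ∀ {n} (x : Pt n) →
                     ∃₂ λ (D : ℕ) (w : Fin n → ℤ) → 0 ℕ.< D × ∀ j → fromℤ (+ D) * x j ≡ fromℤ (w j)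
clear-denominators {zero}  x = 1 , (λ ()) , ℕ.z<s , λ ()
clear-denominators {suc n} x with clear-denominators (x ∘ suc)
... | D , w , 0<D , Dx≡w = D ℕ.* d₀ , w′ , ℕ.*-mono-< 0<D ℕ.z<s , Dd₀x≡w′
  where
  open ≡-Reasoning
  d₀ = ↧ₙ (x zero)
  w′ : Fin (suc n) → ℤ
  w′ zero    = + D ℤ.* ↥ (x zero)
  w′ (suc j) = + d₀ ℤ.* w j
  Dd₀≡D*d₀ : fromℤ (+ (D ℕ.* d₀)) ≡ fromℤ (+ D) * fromℤ (+ d₀)
  Dd₀≡D*d₀ = trans (cong fromℤ (ℤ.pos-* D d₀)) (sym (fromℤ-* (+ D) (+ d₀)))
  Dd₀x≡w′ : ∀ j → fromℤ (+ (D ℕ.* d₀)) * x j ≡ fromℤ (w′ j)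
  Dd₀x≡w′ zero = begin
    fromℤ (+ (D ℕ.* d₀)) * x zero         ≡⟨ cong (_* x zero) Dd₀≡D*d₀ ⟩
    fromℤ (+ D) * fromℤ (+ d₀) * x zero   ≡⟨ *-assoc (fromℤ (+ D)) (fromℤ (+ d₀)) (x zero) ⟩
    fromℤ (+ D) * (fromℤ (+ d₀) * x zero) ≡⟨ cong (fromℤ (+ D) *_) (↧*≡↥ (x zero)) ⟩
    fromℤ (+ D) * fromℤ (↥ x zero)        ≡⟨ fromℤ-* (+ D) (↥ x zero) ⟩
    fromℤ (w′ zero)                       ∎
  Dd₀x≡w′ (suc j) = begin
    fromℤ (+ (D ℕ.* d₀)) * x (suc j)         ≡⟨ cong (_* x (suc j)) Dd₀≡D*d₀ ⟩
    fromℤ (+ D) * fromℤ (+ d₀) * x (suc j)   ≡⟨ solve 3 (λ D d x → D :* d :* x := d :* (D :* x)) refl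
                                                        (fromℤ (+ D)) (fromℤ (+ d₀)) (x (suc j)) ⟩
    fromℤ (+ d₀) * (fromℤ (+ D) * x (suc j)) ≡⟨ cong (fromℤ (+ d₀) *_) (Dx≡w j) ⟩
    fromℤ (+ d₀) * fromℤ (w j)               ≡⟨ fromℤ-* (+ d₀) (w j) ⟩
    fromℤ (w′ (suc j))                       ∎

gcdAll : ∀ {n} → (Fin n → ℕ) → ℕ
gcdAll {zero}  v = 0
gcdAll {suc n} v = gcd (v zero) (gcdAll (v ∘ suc))

gcdAll-∣ : ∀ {n} (v : Fin n → ℕ) j → gcdAll v ℕ.∣ v j
gcdAll-∣ {suc n} v zero    = gcd[m,n]∣m (v zero) (gcdAll (v ∘ suc))
gcdAll-∣ {suc n} v (suc j) = ℕ.∣-trans (gcd[m,n]∣n (v zero) (gcdAll (v ∘ suc))) (gcdAll-∣ (v ∘ suc) j)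

gcdAll-greatest : ∀ {n} (v : Fin n → ℕ) {k} → (∀ j → k ℕ.∣ v j) → k ℕ.∣ gcdAll v
gcdAll-greatest {zero}  v k∣v = _ ℕ.∣0
gcdAll-greatest {suc n} v k∣v = gcd-greatest (k∣v zero) (gcdAll-greatest (v ∘ suc) (k∣v ∘ suc))

Primitive : ∀ {n} → (Fin n → ℤ) → Set
Primitive g = ∀ (k : ℕ) → (∀ j → k ℕ.∣ ℤ.∣ g j ∣) → k ≡ 1

divide-by-gcd : ∀ {n} (w : Fin n → ℤ) → let G = gcdAll (ℤ.∣_∣ ∘ w) in G ≢ 0 →
                ∃ λ g → (∀ j → g j ℤ.* + G ≡ w j) × Primitive g
divide-by-gcd w G≢0 = g , gG≡w , g-primitive
  where
  G = gcdAll (ℤ.∣_∣ ∘ w)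
  quot : ∀ j → ℕ
  quot j = ℕ._∣_.quotient (gcdAll-∣ (ℤ.∣_∣ ∘ w) j)
  ∣w∣≡quot*G : ∀ j → ℤ.∣ w j ∣ ≡ quot j ℕ.* G
  ∣w∣≡quot*G j = ℕ._∣_.equality (gcdAll-∣ (ℤ.∣_∣ ∘ w) j)
  g : Fin _ → ℤ
  g j = sign (w j) ◃ quot j
  gG≡w : ∀ j → g j ℤ.* + G ≡ w j
  gG≡w j = begin
    (sign (w j) ◃ quot j) ℤ.* + G             ≡⟨ cong (g j ℤ.*_) (sym (ℤ.+◃n≡+n G)) ⟩
    (sign (w j) ◃ quot j) ℤ.* (Sign.+ ◃ G)    ≡⟨ sym (ℤ.◃-distrib-* (sign (w j)) Sign.+ (quot j) G) ⟩
    (sign (w j) Sign.* Sign.+) ◃ (quot j ℕ.* G) ≡⟨ cong₂ _◃_ (Sign.*-identityʳ (sign (w j))) (sym (∣w∣≡quot*G j)) ⟩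
    sign (w j) ◃ ℤ.∣ w j ∣                    ≡⟨ ℤ.◃-inverse (w j) ⟩
    w j                                       ∎
    where open ≡-Reasoning
  g-primitive : Primitive g
  g-primitive k k∣g = ℕ.∣1⇒≡1 (ℕ.*-cancelʳ-∣ G {{ℕ.≢-nonZero G≢0}} (subst (k ℕ.* G ℕ.∣_) (sym (ℕ.*-identityˡ G)) kG∣G))
    where
    kG∣w : ∀ j → k ℕ.* G ℕ.∣ ℤ.∣ w j ∣
    kG∣w j = subst (k ℕ.* G ℕ.∣_) (sym (∣w∣≡quot*G j))
                   (ℕ.*-monoˡ-∣ G (subst (k ℕ.∣_) (ℤ.abs-◃ (sign (w j)) (quot j)) (k∣g j)))
    kG∣G : k ℕ.* G ℕ.∣ G
    kG∣G = gcdAll-greatest (ℤ.∣_∣ ∘ w) kG∣w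

primitive-multiple : ∀ {n} (x : Pt n) → (∃ λ j → x j ≢ 0ℚ) →
                     ∃₂ λ (g : Fin n → ℤ) (c : ℚ) → 0ℚ < c × (∀ j → x j ≡ c * ofℤ g j) × Primitive g
primitive-multiple x (j₀ , xⱼ₀≢0) with clear-denominators x
... | D , w , 0<D , Dx≡w = g , c , 0<c , x≡cg , g-primitive
  where
  open ≡-Reasoning
  G = gcdAll (ℤ.∣_∣ ∘ w)
  D̂ = fromℤ (+ D)
  0<D̂ : 0ℚ < D̂
  0<D̂ = fromℤ-pos 0<D
  instance
    _ = pos⇒nonZero D̂ {{positive 0<D̂}}
  G≢0 : G ≢ 0
  G≢0 G≡0 = xⱼ₀≢0 (*-cancelˡ-≡0 (>⇒≢ 0<D̂) (trans (Dx≡w j₀) (cong fromℤ wⱼ₀≡0)))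
    where
    wⱼ₀≡0 : w j₀ ≡ + 0
    wⱼ₀≡0 = ℤ.∣i∣≡0⇒i≡0 (ℕ.0∣⇒≡0 (subst (ℕ._∣ ℤ.∣ w j₀ ∣) G≡0 (gcdAll-∣ (ℤ.∣_∣ ∘ w) j₀)))
  g = proj₁ (divide-by-gcd w G≢0)
  gG≡w = proj₁ (proj₂ (divide-by-gcd w G≢0))
  g-primitive = proj₂ (proj₂ (divide-by-gcd w G≢0))
  c = fromℤ (+ G) * 1/ D̂
  0<c : 0ℚ < c
  0<c = *-pos (fromℤ-pos (ℕ.n≢0⇒n>0 G≢0)) (positive⁻¹ (1/ D̂) {{1/pos⇒pos D̂ {{positive 0<D̂}}}})
  x≡cg : ∀ j → x j ≡ c * ofℤ g j
  x≡cg j = begin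
    x j                              ≡⟨ sym (*-identityˡ (x j)) ⟩
    1ℚ * x j                         ≡⟨ cong (_* x j) (sym (*-inverseˡ D̂)) ⟩
    1/ D̂ * D̂ * x j                   ≡⟨ *-assoc (1/ D̂) D̂ (x j) ⟩
    1/ D̂ * (D̂ * x j)                 ≡⟨ cong (1/ D̂ *_) (Dx≡w j) ⟩
    1/ D̂ * fromℤ (w j)               ≡⟨ cong (λ i → 1/ D̂ * fromℤ i) (sym (gG≡w j)) ⟩
    1/ D̂ * fromℤ (g j ℤ.* + G)       ≡⟨ cong (1/ D̂ *_) (sym (fromℤ-* (g j) (+ G))) ⟩
    1/ D̂ * (fromℤ (g j) * fromℤ (+ G)) ≡⟨ solve 3 (λ d g G → d :* (g :* G) := (G :* d) :* g)
                                                 refl (1/ D̂) (fromℤ (g j)) (fromℤ (+ G)) ⟩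
    c * fromℤ (g j)                  ≡⟨ cong (c *_) (sym (/1≡fromℤ (g j))) ⟩
    c * ofℤ g j                      ∎

negℤ : ∀ {n} → (Fin n → ℤ) → Fin n → ℤ
negℤ g j = ℤ.- g j

ofℤ-negℤ : ∀ {n} (g : Fin n → ℤ) j → ofℤ (negℤ g) j ≡ - ofℤ g j
ofℤ-negℤ g j = begin
  ℤ.- g j / 1       ≡⟨ /1≡fromℤ (ℤ.- g j) ⟩
  fromℤ (ℤ.- g j)   ≡⟨ fromℤ-neg (g j) ⟩
  - fromℤ (g j)     ≡⟨ cong -_ (sym (/1≡fromℤ (g j))) ⟩
  - (g j / 1)       ∎
  where
  open ≡-Reasoning
  fromℤ-neg : ∀ i → fromℤ (ℤ.- i) ≡ - fromℤ i
  fromℤ-neg (+ zero)  = refl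
  fromℤ-neg (+ suc _) = refl
  fromℤ-neg -[1+ _ ]  = refl

mul-negℤ : ∀ {m n} (M : Mat m n) g i → mul M (ofℤ (negℤ g)) i ≡ - mul M (ofℤ g) i
mul-negℤ M g i = trans (dot-cong (M i) (ofℤ-negℤ g)) (dot-negate (M i) (ofℤ g))

opposite-inject₁ : ∀ {k} (i : Fin k) → opposite (inject₁ i) ≡ suc (opposite i)
opposite-inject₁ {suc k} zero    = refl
opposite-inject₁ {suc k} (suc i) = cong inject₁ (opposite-inject₁ i)

opposite-fromℕ : ∀ k → opposite (fromℕ k) ≡ zero
opposite-fromℕ zero    = refl
opposite-fromℕ (suc k) = cong inject₁ (opposite-fromℕ k)

module _ {A : Set} where

  Steps : (A → A → Set) → ∀ k → (Fin (suc k) → A) → Set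
  Steps T k y = ∀ (i : Fin k) → T (y (inject₁ i)) (y (suc i))

  Steps-opposite : ∀ {T k y} → Steps (flip T) k y → Steps T k (y ∘ opposite)
  Steps-opposite {T} {k} {y} back i =
    subst (λ j → T (y j) (y (opposite (suc i)))) (sym (opposite-inject₁ i)) (back (opposite i))

  Steps-opposite⁻ : ∀ {T k y} → Steps T k (y ∘ opposite) → Steps (flip T) k y
  Steps-opposite⁻ {T} {k} {y} steps i =
    subst₂ (λ j j′ → T (y j) (y j′))
           (trans (opposite-inject₁ (opposite i)) (cong suc (opposite-involutive i)))
           (cong inject₁ (opposite-involutive i))
           (steps (opposite i))

  Steps-all : ∀ {T k y} (Q : A → Set) → (∀ {a b} → T a b → Q a) → Q (y (fromℕ k)) → Steps T k y → ∀ i → Q (y i)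
  Steps-all {k = zero}  Q source Qlast steps zero    = Qlast
  Steps-all {k = suc k} Q source Qlast steps zero    = source (steps zero)
  Steps-all {T} {k = suc k} {y} Q source Qlast steps (suc i) = Steps-all {T} {y = y ∘ suc} Q source Qlast (λ j → steps (suc j)) i

  module _ {T : A → A → Set} where

    length : ∀ {a b} → Star T a b → ℕ
    length done    = 0
    length (_ ◅ p) = suc (length p)

    points : ∀ {a b} (p : Star T a b) → Fin (suc (length p)) → A
    points {a} p   zero    = a
    points (_ ◅ p) (suc i) = points p i

    points-last : ∀ {a b} (p : Star T a b) → points p (fromℕ (length p)) ≡ b
    points-last done    = refl
    points-last (_ ◅ p) = points-last p

    points-steps : ∀ {a b} (p : Star T a b) → Steps T (length p) (points p)
    points-steps (s ◅ p) zero    = s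
    points-steps (s ◅ p) (suc i) = points-steps p i

    prefix : ∀ {k y} → Steps T k y → ∀ i → Star T (y zero) (y i)
    prefix         steps zero    = done
    prefix {suc k} {y} steps (suc i) = steps zero ◅ prefix {y = y ∘ suc} (λ j → steps (suc j)) i

    Steps-suffix : ∀ {a b c} (p : Star T a b) (q : Star T b c) →
                   Steps (flip T) (length (p ◅◅ q)) (points (p ◅◅ q)) → Steps (flip T) (length q) (points q)
    Steps-suffix done    q back = back
    Steps-suffix (_ ◅ p) q back = Steps-suffix p q (back ∘ suc)

module Polyhedral {n : ℕ} (P : Polyhedron n) where
  open Polyhedron P

  private
    variable
      x y u : Pt n

  InP : Pt n → Set
  InP = _∈P P

  slack : Pt n → Fin m₂ → ℚ
  slack x r = d r - mul B x r

  InP-cong : (∀ j → x j ≡ y j) → InP x → InP y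
  InP-cong {x} {y} x≗y (Ax≡b , Bx≤d) =
    (λ i → trans (sym (dot-cong (A i) x≗y)) (Ax≡b i)) , (λ r → subst (_≤ d r) (dot-cong (B r) x≗y) (Bx≤d r))

  slack-nonneg : InP x → ∀ r → 0ℚ ≤ slack x r
  slack-nonneg {x} (_ , Bx≤d) r = p+q≤r⇒q≤r-p (subst (_≤ d r) (sym (+-identityʳ (mul B x r))) (Bx≤d r))

  slack-addScaled : ∀ x t u r → slack (addScaled x t u) r ≡ slack x r - t * mul B u r
  slack-addScaled x t u r = begin
    d r - dot (B r) (addScaled x t u)    ≡⟨ cong (λ z → d r - z) (dot-addScaled (B r) x u t) ⟩
    d r - (mul B x r + t * mul B u r)    ≡⟨ solve 3 (λ d b c → d :- (b :+ c) := (d :- b) :- c) refl (d r) (mul B x r) (t * mul B u r) ⟩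
    slack x r - t * mul B u r            ∎
    where open ≡-Reasoning

  addScaled-InP : InP x → InKerA P u → (∀ r → t * mul B u r ≤ slack x r) → InP (addScaled x t u)
  addScaled-InP {x} {u} {t} (Ax≡b , _) Au≡0 t*Bu≤slack = A-rows , B-rows
    where
    A-rows : ∀ i → mul A (addScaled x t u) i ≡ b i
    A-rows i = begin
      dot (A i) (addScaled x t u) ≡⟨ dot-addScaled (A i) x u t ⟩
      mul A x i + t * mul A u i   ≡⟨ cong₂ (λ a c → a + t * c) (Ax≡b i) (Au≡0 i) ⟩
      b i + t * 0ℚ                ≡⟨ solve 2 (λ b t → b :+ t :* con 0ℚ := b) refl (b i) t ⟩
      b i                         ∎
      where open ≡-Reasoning
    B-rows : ∀ r → mul B (addScaled x t u) r ≤ d r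
    B-rows r = subst (_≤ d r) (sym (dot-addScaled (B r) x u t)) (q≤r-p⇒p+q≤r (t*Bu≤slack r))

  InP-addScaled-bound : InP (addScaled x t u) → ∀ r → t * mul B u r ≤ slack x r
  InP-addScaled-bound {x} {t} {u} (_ , B≤d) r =
    p+q≤r⇒q≤r-p (subst (_≤ d r) (dot-addScaled (B r) x u t) (B≤d r))

  InP-addScaled-kerA : InP x → InP (addScaled x t u) → t ≢ 0ℚ → InKerA P u
  InP-addScaled-kerA {x} {t} {u} (Ax≡b , _) (Ax′≡b , _) t≢0 i = *-cancelˡ-≡0 t≢0 (begin
    t * mul A u i                           ≡⟨ solve 2 (λ a c → c := (a :+ c) :- a) refl (mul A x i) (t * mul A u i) ⟩
    (mul A x i + t * mul A u i) - mul A x i ≡⟨ cong₂ _-_ (trans (sym (dot-addScaled (A i) x u t)) (Ax′≡b i)) (Ax≡b i) ⟩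
    b i - b i                               ≡⟨ +-inverseʳ (b i) ⟩
    0ℚ                                      ∎)
    where open ≡-Reasoning

  segment : ∀ {α} → InP x → InP (addScaled x α u) → 0ℚ < α → 0ℚ ≤ t → t ≤ α → InP (addScaled x t u)
  segment {x = x} {u = u} {t = t} {α = α} x∈P x′∈P 0<α 0≤t t≤α =
    addScaled-InP {t = t} x∈P (InP-addScaled-kerA {t = α} {u = u} x∈P x′∈P (>⇒≢ 0<α)) t*Bu≤slack
    where
    t*Bu≤slack : ∀ r → t * mul B u r ≤ slack x r
    t*Bu≤slack r with ≤-total (mul B u r) 0ℚ
    ... | inj₁ Bu≤0 = ≤-trans (*-nonNeg-nonPos 0≤t Bu≤0) (slack-nonneg x∈P r)
    ... | inj₂ 0≤Bu = ≤-trans (*-monoʳ-≤-nonNeg (mul B u r) {{nonNegative 0≤Bu}} t≤α) (InP-addScaled-bound {t = α} {u = u} x′∈P r)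

  lineality-InP : InP x → InKerA P u → (∀ r → mul B u r ≡ 0ℚ) → ∀ t → InP (addScaled x t u)
  lineality-InP {x} {u} x∈P Au≡0 Bu≡0 t = addScaled-InP {t = t} x∈P Au≡0 λ r →
    subst (_≤ slack x r) (sym (trans (cong (t *_) (Bu≡0 r)) (*-zeroʳ t))) (slack-nonneg x∈P r)

  vertex-not-interior : ∀ {α γ} → IsVertex P x → 0ℚ < α → 0ℚ < γ →
                        InP (addScaled x α u) → InP (addScaled x γ (-ᵛ u)) → ∀ j → u j ≡ 0ℚ
  vertex-not-interior {x = x} {u = u} {α = α} {γ = γ} (x∈P , extreme) 0<α 0<γ x+αu∈P x-γu∈P j =
    *-cancelˡ-≡0 (>⇒≢ 0<δ) (extreme (scale δ u) x+δu∈P x-δu∈P j)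
    where
    δ = α ⊓ γ
    0<δ : 0ℚ < δ
    0<δ with ⊓-sel α γ
    ... | inj₁ δ≡α = subst (0ℚ <_) (sym δ≡α) 0<α
    ... | inj₂ δ≡γ = subst (0ℚ <_) (sym δ≡γ) 0<γ
    x+δu∈P : InP (addScaled x 1ℚ (scale δ u))
    x+δu∈P = InP-cong (λ j → cong (λ z → x j + z) (sym (*-identityˡ (δ * u j))))
                      (segment {t = δ} x∈P x+αu∈P 0<α (<⇒≤ 0<δ) (p⊓q≤p α γ))
    x-δu∈P : InP (addScaled x (0ℚ - 1ℚ) (scale δ u))
    x-δu∈P = InP-cong (λ j → cong (λ z → x j + z) (solve 2 (λ δ u → δ :* (:- u) := (con 0ℚ :- con 1ℚ) :* (δ :* u)) refl δ (u j)))
                      (segment {t = δ} x∈P x-γu∈P 0<γ (<⇒≤ 0<δ) (p⊓q≤q α γ))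

  vertex⇒pointed : IsVertex P x → InKerA P u → (∀ r → mul B u r ≡ 0ℚ) → ∀ j → u j ≡ 0ℚ
  vertex⇒pointed {u = u} x-vertex@(x∈P , _) Au≡0 Bu≡0 =
    vertex-not-interior x-vertex (positive⁻¹ 1ℚ) (positive⁻¹ 1ℚ)
      (lineality-InP x∈P Au≡0 Bu≡0 1ℚ)
      (lineality-InP x∈P (λ i → trans (dot-negate (A i) u) (cong -_ (Au≡0 i)))
                         (λ r → trans (dot-negate (B r) u) (cong -_ (Bu≡0 r))) 1ℚ)

  Elementary : Pt n → Set
  Elementary x = InKerA P x × NonZeroPt P x × ¬ (∃ λ z → InKerA P z × NonZeroPt P z × SuppStrictSub P z x)

  elementary-rescale : p ≢ 0ℚ → (∀ j → x j ≡ p * y j) → Elementary x → Elementary y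
  elementary-rescale {p} {x} {y} p≢0 x≡py (Ax≡0 , (j , xⱼ≢0) , x-minimal) = Ay≡0 , (j , yⱼ≢0) , y-minimal
    where
    Ay≡0 : InKerA P y
    Ay≡0 i = *-cancelˡ-≡0 p≢0 (trans (sym (mul-rescale A p y x≡py i)) (Ax≡0 i))
    yⱼ≢0 : y j ≢ 0ℚ
    yⱼ≢0 = Equivalence.to (scale-≢0 p≢0) (subst (_≢ 0ℚ) (x≡py j) xⱼ≢0)
    By⊆Bx : mul B y ⊆ˢ mul B x
    By⊆Bx = rescale-⊆ˢ B p y p≢0 x≡py
    y-minimal : ¬ (∃ λ z → InKerA P z × NonZeroPt P z × SuppStrictSub P z y)
    y-minimal (z , Az≡0 , z≢0 , Bz⊆By , (i , Byᵢ≢0 , Bzᵢ≡0)) =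
      x-minimal (z , Az≡0 , z≢0 , ⊆ˢ-trans Bz⊆By By⊆Bx , (i , By⊆Bx i Byᵢ≢0 , Bzᵢ≡0))

  circuit⇒elementary : ∀ {g} → IsCircuit P g → Elementary (ofℤ g)
  circuit⇒elementary (Ag≡0 , g≢0 , _ , minimal) = Ag≡0 , g≢0 , minimal

  circuit-negℤ : ∀ {g} → IsCircuit P g → IsCircuit P (negℤ g)
  circuit-negℤ {g} g-circuit@(_ , _ , g-coprime , _) = Ag≡0 , g≢0 , coprime , minimal
    where
    g≡-1*[-g] : ∀ j → ofℤ g j ≡ - 1ℚ * ofℤ (negℤ g) j
    g≡-1*[-g] j = trans (solve 1 (λ a → a := (:- con 1ℚ) :* (:- a)) refl (ofℤ g j))
                      (cong (- 1ℚ *_) (sym (ofℤ-negℤ g j)))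
    elementary = elementary-rescale {p = - 1ℚ} {x = ofℤ g} {y = ofℤ (negℤ g)} (λ ()) g≡-1*[-g] (circuit⇒elementary {g} g-circuit)
    Ag≡0 = proj₁ elementary
    g≢0 = proj₁ (proj₂ elementary)
    minimal = proj₂ (proj₂ elementary)
    coprime : Coprime P (negℤ g)
    coprime k k∣-g = g-coprime k (λ j → subst (k ℕ.∣_) (ℤ.∣-i∣≡∣i∣ (g j)) (k∣-g j))

  ratio : (x u : Pt n) → ∀ r → .(0ℚ < mul B u r) → ℚ
  ratio x u r 0<Bu = slack x r * (1/ mul B u r) {{pos⇒nonZero (mul B u r) {{positive 0<Bu}}}}

  ratio-* : ∀ x u r (0<Bu : 0ℚ < mul B u r) → ratio x u r 0<Bu * mul B u r ≡ slack x r
  ratio-* x u r 0<Bu = begin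
    slack x r * 1/ Bu * Bu   ≡⟨ *-assoc (slack x r) (1/ Bu) Bu ⟩
    slack x r * (1/ Bu * Bu) ≡⟨ cong (slack x r *_) (*-inverseˡ Bu) ⟩
    slack x r * 1ℚ           ≡⟨ *-identityʳ (slack x r) ⟩
    slack x r                ∎
    where
    open ≡-Reasoning
    Bu = mul B u r
    instance
      _ = pos⇒nonZero Bu {{positive 0<Bu}}

  record MaximalStep (x u : Pt n) : Set where
    field
      α : ℚ
      α-pos : 0ℚ < α
      feasible : InP (addScaled x α u)
      maximal : ∀ β → α < β → ¬ InP (addScaled x β u)
      blocking : ∃ λ r → mul B u r ≢ 0ℚ × slack (addScaled x α u) r ≡ 0ℚ

  maximal-step : InP x → InKerA P u → (∀ r → mul B u r ≢ 0ℚ → 0ℚ < slack x r) →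
                 (∃ λ r → 0ℚ < mul B u r) → MaximalStep x u
  maximal-step {x} {u} x∈P Au≡0 slack-pos (r₀ , 0<Bu₀) with argmin (λ r → 0ℚ <? mul B u r) (ratio x u)
  ... | inj₁ none = contradiction 0<Bu₀ (none r₀)
  ... | inj₂ (r* , 0<Bu* , least) = record
    { α = α ; α-pos = α-pos ; feasible = feasible ; maximal = maximal
    ; blocking = r* , >⇒≢ 0<Bu* , blocked }
    where
    α = ratio x u r* 0<Bu*
    α-pos : 0ℚ < α
    α-pos = *-pos (slack-pos r* (>⇒≢ 0<Bu*)) (positive⁻¹ _ {{1/pos⇒pos (mul B u r*) {{positive 0<Bu*}}}})
    feasible : InP (addScaled x α u)
    feasible = addScaled-InP {t = α} x∈P Au≡0 α*Bu≤slack
      where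
      α*Bu≤slack : ∀ r → α * mul B u r ≤ slack x r
      α*Bu≤slack r with 0ℚ <? mul B u r
      ... | yes 0<Bu = subst (α * mul B u r ≤_) (ratio-* x u r 0<Bu)
                             (*-monoʳ-≤-nonNeg (mul B u r) {{nonNegative (<⇒≤ 0<Bu)}} (least r 0<Bu))
      ... | no  0≮Bu = ≤-trans (*-nonNeg-nonPos (<⇒≤ α-pos) (≮⇒≥ 0≮Bu)) (slack-nonneg x∈P r)
    blocked : slack (addScaled x α u) r* ≡ 0ℚ
    blocked = begin
      slack (addScaled x α u) r*    ≡⟨ slack-addScaled x α u r* ⟩
      slack x r* - α * mul B u r*   ≡⟨ cong (λ z → slack x r* - z) (ratio-* x u r* 0<Bu*) ⟩
      slack x r* - slack x r*       ≡⟨ +-inverseʳ (slack x r*) ⟩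
      0ℚ                            ∎
      where open ≡-Reasoning
    maximal : ∀ β → α < β → ¬ InP (addScaled x β u)
    maximal β α<β x+βu∈P = <-irrefl refl (<-≤-trans slack<β*Bu (InP-addScaled-bound {t = β} {u = u} x+βu∈P r*))
      where
      slack<β*Bu : slack x r* < β * mul B u r*
      slack<β*Bu = subst (_< β * mul B u r*) (ratio-* x u r* 0<Bu*)
                         (*-monoˡ-<-pos (mul B u r*) {{positive 0<Bu*}} α<β)

  positive-step : InP x → InKerA P u → (∀ r → mul B u r ≢ 0ℚ → 0ℚ < slack x r) →
                  ∃ λ ε → 0ℚ < ε × InP (addScaled x ε u)
  positive-step {x} {u} x∈P Au≡0 slack-pos with any? (λ r → 0ℚ <? mul B u r)
  ... | yes increasing = α , α-pos , feasible
    where open MaximalStep (maximal-step x∈P Au≡0 slack-pos increasing)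
  ... | no ¬increasing = 1ℚ , positive⁻¹ 1ℚ , addScaled-InP {t = 1ℚ} x∈P Au≡0 λ r →
    ≤-trans (*-nonNeg-nonPos (nonNegative⁻¹ 1ℚ) (≮⇒≥ (¬increasing ∘ (r ,_)))) (slack-nonneg x∈P r)

  step-not-extendable : CircuitStep P x y → 0ℚ < s → ¬ InP (addScaled y s (λ j → y j - x j))
  step-not-extendable {x} {y} {s} (_ , g , _ , α , 0<α , y≡x+αg , maximal) 0<s y+s[y-x]∈P =
    maximal (α + s * α) α<α+sα (InP-cong overshoot y+s[y-x]∈P)
    where
    α<α+sα : α < α + s * α
    α<α+sα = subst (_< α + s * α) (+-identityʳ α) (+-monoʳ-< α (*-pos 0<s 0<α))
    overshoot : ∀ j → y j + s * (y j - x j) ≡ x j + (α + s * α) * ofℤ g j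
    overshoot j = begin
      y j + s * (y j - x j)
        ≡⟨ cong (λ z → z + s * (z - x j)) (y≡x+αg j) ⟩
      (x j + α * ofℤ g j) + s * ((x j + α * ofℤ g j) - x j)
        ≡⟨ solve 4 (λ x α g s → (x :+ α :* g) :+ s :* ((x :+ α :* g) :- x) := x :+ (α :+ s :* α) :* g)
                   refl (x j) α (ofℤ g j) s ⟩
      x j + (α + s * α) * ofℤ g j ∎
      where open ≡-Reasoning

  reverse-step : IsVertex P x → InP y → CircuitStep P x y → CircuitStep P y x
  reverse-step {x} {y} x-vertex y∈P (_ , g , g-circuit , α , 0<α , y≡x+αg , _) =
    y∈P , negℤ g , circuit-negℤ {g} g-circuit , α , 0<α , x≡y-αg , maximal
    where
    open ≡-Reasoning
    ĝ = ofℤ g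
    x≡y-αg : ∀ j → x j ≡ addScaled y α (ofℤ (negℤ g)) j
    x≡y-αg j = begin
      x j                          ≡⟨ solve 3 (λ x α u → x := (x :+ α :* u) :+ α :* (:- u)) refl (x j) α (ĝ j) ⟩
      (x j + α * ĝ j) + α * - ĝ j  ≡⟨ cong₂ (λ a c → a + α * c) (sym (y≡x+αg j)) (sym (ofℤ-negℤ g j)) ⟩
      y j + α * ofℤ (negℤ g) j     ∎
    maximal : ∀ β → α < β → ¬ InP (addScaled y β (ofℤ (negℤ g)))
    maximal β α<β y-βg∈P = gⱼ≢0 (vertex-not-interior x-vertex 0<α (p<q⇒0<q-p α<β)
                                   (InP-cong y≡x+αg y∈P) (InP-cong beyond y-βg∈P) j)
      where
      j = proj₁ (proj₁ (proj₂ g-circuit))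
      gⱼ≢0 = proj₂ (proj₁ (proj₂ g-circuit))
      beyond : ∀ j → y j + β * ofℤ (negℤ g) j ≡ x j + (β - α) * - ĝ j
      beyond j = begin
        y j + β * ofℤ (negℤ g) j        ≡⟨ cong₂ (λ a c → a + β * c) (y≡x+αg j) (ofℤ-negℤ g j) ⟩
        (x j + α * ĝ j) + β * - ĝ j     ≡⟨ solve 4 (λ x α u β → (x :+ α :* u) :+ β :* (:- u) := x :+ (β :- α) :* (:- u))
                                                   refl (x j) α (ĝ j) β ⟩
        x j + (β - α) * - ĝ j           ∎

  circuit-below : ∀ {e} → InKerA P e → NonZeroPt P e →
                  ¬ ¬ (∃ λ g → IsCircuit P g × mul B (ofℤ g) ⊆ˢ mul B e)
  circuit-below {e} Ae≡0 e≢0 = do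
    (x , (Ax≡0 , x≢0 , Bx⊆Be) , least) ← ¬¬-minimal Below (λ x → ∣ support (mul B x) ∣) (Ae≡0 , e≢0 , λ _ → id)
    let (g , c , 0<c , x≡cg , g-primitive) = primitive-multiple x x≢0
        (Ag≡0 , g≢0 , g-minimal) = elementary-rescale (>⇒≢ 0<c) x≡cg (Ax≡0 , x≢0 , minimal x (Ax≡0 , x≢0 , Bx⊆Be) least)
    return (g , (Ag≡0 , g≢0 , g-primitive , g-minimal) , ⊆ˢ-trans (rescale-⊆ˢ B c (ofℤ g) (>⇒≢ 0<c) x≡cg) Bx⊆Be)
    where
    Below : Pt n → Set
    Below x = InKerA P x × NonZeroPt P x × mul B x ⊆ˢ mul B e
    minimal : ∀ x → Below x → (∀ z → Below z → ∣ support (mul B x) ∣ ℕ.≤ ∣ support (mul B z) ∣) →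
              ¬ (∃ λ z → InKerA P z × NonZeroPt P z × SuppStrictSub P z x)
    minimal x (_ , _ , Bx⊆Be) least (z , Az≡0 , z≢0 , Bz⊆Bx , smaller) =
      ℕ.<⇒≱ (∣support∣-< Bz⊆Bx smaller) (least z (Az≡0 , z≢0 , ⊆ˢ-trans Bz⊆Bx Bx⊆Be))

  tight-rows-fixed : ∀ {e} → InP x → InP (addScaled x 1ℚ e) → InP (addScaled x (0ℚ - 1ℚ) e) →
                     ∀ r → mul B e r ≢ 0ℚ → 0ℚ < slack x r
  tight-rows-fixed {x} {e} x∈P x+e∈P x-e∈P r Beᵣ≢0 =
    ≤∧≢⇒< (slack-nonneg x∈P r) λ 0≡slack → Beᵣ≢0 (≤-antisym (Be≤0 0≡slack) (0≤Be 0≡slack))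
    where
    Be = mul B e r
    Be≤0 : 0ℚ ≡ slack x r → Be ≤ 0ℚ
    Be≤0 0≡slack = subst₂ _≤_ (*-identityˡ Be) (sym 0≡slack) (InP-addScaled-bound {t = 1ℚ} {u = e} x+e∈P r)
    0≤Be : 0ℚ ≡ slack x r → 0ℚ ≤ Be
    0≤Be 0≡slack = subst₂ _≤_ (+-inverseʳ Be) (+-identityʳ Be) (+-monoʳ-≤ Be -Be≤0)
      where
      -Be≤0 : - Be ≤ 0ℚ
      -Be≤0 = subst₂ _≤_ (solve 1 (λ b → (con 0ℚ :- con 1ℚ) :* b := :- b) refl Be) (sym 0≡slack)
                     (InP-addScaled-bound {t = 0ℚ - 1ℚ} {u = e} x-e∈P r)

  record Escape (x : Pt n) : Set where
    field
      target : Pt n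
      target-InP : InP target
      step : CircuitStep P x target
      fewer-slack : ∣ support (slack target) ∣ ℕ.< ∣ support (slack x) ∣
      room-behind : ∃ λ s → 0ℚ < s × InP (addScaled x s (λ j → x j - target j))

  escape-along : ∀ {g} → InP x → IsCircuit P g → (∀ r → mul B (ofℤ g) r ≢ 0ℚ → 0ℚ < slack x r) →
                 (∃ λ r → 0ℚ < mul B (ofℤ g) r) → Escape x
  escape-along {x} {g} x∈P g-circuit slack-pos increasing = record
    { target = x′ ; target-InP = feasible
    ; step = x∈P , g , g-circuit , α , α-pos , (λ _ → refl) , maximal
    ; fewer-slack = ∣support∣-< slack-⊆ (r* , >⇒≢ (slack-pos r* Bgᵣ*≢0) , slack′ᵣ*≡0)
    ; room-behind = σ , 0<σ , InP-cong behind≡room behind∈P }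
    where
    Ag≡0 = proj₁ g-circuit
    open MaximalStep (maximal-step x∈P Ag≡0 slack-pos increasing)
    x′ = addScaled x α (ofℤ g)
    r* = proj₁ blocking
    Bgᵣ*≢0 = proj₁ (proj₂ blocking)
    slack′ᵣ*≡0 = proj₂ (proj₂ blocking)
    slack-⊆ : slack x′ ⊆ˢ slack x
    slack-⊆ r slack′ᵣ≢0 with mul B (ofℤ g) r ≟ 0ℚ
    ... | no  Bgᵣ≢0 = >⇒≢ (slack-pos r Bgᵣ≢0)
    ... | yes Bgᵣ≡0 = subst (_≢ 0ℚ) (trans (slack-addScaled x α (ofℤ g) r) unchanged) slack′ᵣ≢0
      where
      unchanged : slack x r - α * mul B (ofℤ g) r ≡ slack x r
      unchanged = trans (cong (λ z → slack x r - α * z) Bgᵣ≡0)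
                        (solve 2 (λ s α → s :- α :* con 0ℚ := s) refl (slack x r) α)
    -α≢0 : - α ≢ 0ℚ
    -α≢0 -α≡0 = >⇒≢ α-pos (neg-injective -α≡0)
    behind = positive-step x∈P
      (λ i → trans (dot-scale (A i) (ofℤ g) (- α)) (trans (cong (- α *_) (Ag≡0 i)) (*-zeroʳ (- α))))
      (λ r → slack-pos r ∘ Equivalence.to (scale-≢0 -α≢0) ∘ subst (_≢ 0ℚ) (dot-scale (B r) (ofℤ g) (- α)))
    σ = proj₁ behind
    0<σ = proj₁ (proj₂ behind)
    behind∈P = proj₂ (proj₂ behind)
    behind≡room : ∀ j → x j + σ * (- α * ofℤ g j) ≡ x j + σ * (x j - x′ j)
    behind≡room j = cong (λ z → x j + σ * z)
      (solve 3 (λ x α g → :- α :* g := x :- (x :+ α :* g)) refl (x j) α (ofℤ g j))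

  -- As P has a vertex, the circuit is not a lineality direction: it moves some row of B, and
  -- after a change of sign it increases that row, which is what makes a maximal step exist.
  escape : ∀ {v e} → IsVertex P v → InP x → InP (addScaled x 1ℚ e) → InP (addScaled x (0ℚ - 1ℚ) e) →
           NonZeroPt P e → ¬ ¬ Escape x
  escape {x} {v} {e} v-vertex x∈P x+e∈P x-e∈P e≢0 = do
    (g , g-circuit , Bg⊆Be) ← circuit-below (InP-addScaled-kerA {t = 1ℚ} {u = e} x∈P x+e∈P 1≢0) e≢0
    return (oriented {g} g-circuit (λ r → tight-rows-fixed x∈P x+e∈P x-e∈P r ∘ Bg⊆Be r))
    where
    oriented : ∀ {g} → IsCircuit P g → (∀ r → mul B (ofℤ g) r ≢ 0ℚ → 0ℚ < slack x r) → Escape x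
    oriented {g} g-circuit@(Ag≡0 , (j , gⱼ≢0) , _) slack-pos = orient moving-row
      where
      moving-row : ∃ λ r → mul B (ofℤ g) r ≢ 0ℚ
      moving-row = ¬∀⟶∃¬ m₂ (λ r → mul B (ofℤ g) r ≡ 0ℚ) (λ r → mul B (ofℤ g) r ≟ 0ℚ)
                          (λ Bg≡0 → gⱼ≢0 (vertex⇒pointed v-vertex Ag≡0 Bg≡0 j))
      orient : (∃ λ r → mul B (ofℤ g) r ≢ 0ℚ) → Escape x
      orient (r , Bgᵣ≢0) with <-cmp (mul B (ofℤ g) r) 0ℚ
      ... | tri> _ _ 0<Bgᵣ = escape-along {g = g} x∈P g-circuit slack-pos (r , 0<Bgᵣ)
      ... | tri≈ _ Bgᵣ≡0 _ = contradiction Bgᵣ≡0 Bgᵣ≢0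
      ... | tri< Bgᵣ<0 _ _ = escape-along {g = negℤ g} x∈P (circuit-negℤ {g} g-circuit) slack-pos′
                               (r , subst (0ℚ <_) (sym (mul-negℤ B g r)) (neg-antimono-< Bgᵣ<0))
        where
        slack-pos′ : ∀ r → mul B (ofℤ (negℤ g)) r ≢ 0ℚ → 0ℚ < slack x r
        slack-pos′ r B-gᵣ≢0 = slack-pos r λ Bgᵣ≡0 → B-gᵣ≢0 (trans (mul-negℤ B g r) (cong -_ Bgᵣ≡0))

  vertex-unless-escapable : InP x → (∀ e → InP (addScaled x 1ℚ e) → InP (addScaled x (0ℚ - 1ℚ) e) → ¬ NonZeroPt P e) →
                            IsVertex P x
  vertex-unless-escapable x∈P no-escape =
    x∈P , λ e x+e∈P x-e∈P j → decidable-stable (e j ≟ 0ℚ) (λ eⱼ≢0 → no-escape e x+e∈P x-e∈P (j , eⱼ≢0))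

  reach-vertex : ∀ {v} → IsVertex P v → InP x → ¬ ¬ (∃ λ w → IsVertex P w × Star (CircuitStep P) x w)
  reach-vertex {x} v-vertex x∈P = do
    (w , (w∈P , x⇝w) , least) ← ¬¬-minimal Reachable (λ y → ∣ support (slack y) ∣) (x∈P , done)
    return (w , vertex-unless-escapable w∈P (no-escape w∈P x⇝w least) , x⇝w)
    where
    Reachable : Pt n → Set
    Reachable y = InP y × Star (CircuitStep P) x y
    no-escape : ∀ {w} → InP w → Star (CircuitStep P) x w →
                (∀ y → Reachable y → ∣ support (slack w) ∣ ℕ.≤ ∣ support (slack y) ∣) →
                ∀ e → InP (addScaled w 1ℚ e) → InP (addScaled w (0ℚ - 1ℚ) e) → ¬ NonZeroPt P e
    no-escape w∈P x⇝w least e w+e∈P w-e∈P e≢0 = escape v-vertex w∈P w+e∈P w-e∈P e≢0 λ esc →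
      ℕ.<⇒≱ (Escape.fewer-slack esc)
            (least (Escape.target esc) (Escape.target-InP esc , x⇝w ◅◅ (Escape.step esc ◅ done)))

  walk-InP : ∀ {k y} → IsCircuitWalk P k y → ∀ i → InP (y i)
  walk-InP {k} {y} (_ , (yₖ∈P , _) , steps) = Steps-all {T = CircuitStep P} {k} {y} InP proj₁ yₖ∈P steps

  path-walk : ∀ {a b} (p : Star (CircuitStep P) a b) → IsVertex P a → IsVertex P b →
              IsCircuitWalk P (length p) (points p)
  path-walk p a-vertex b-vertex = a-vertex , subst (IsVertex P) (sym (points-last p)) b-vertex , points-steps p

  escape-irreversible : AllWalksReversible P → ∀ {a w} → IsVertex P a → IsVertex P w →
                        Star (CircuitStep P) a x → (esc : Escape x) → Star (CircuitStep P) (Escape.target esc) w → ⊥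
  escape-irreversible {x} reversible a-vertex w-vertex a⇝x esc x′⇝w =
    step-not-extendable back-step (proj₁ (proj₂ room-behind)) (proj₂ (proj₂ room-behind))
    where
    open Escape esc
    path = a⇝x ◅◅ (step ◅ x′⇝w)
    reversed-steps : Steps (flip (CircuitStep P)) (length path) (points path)
    reversed-steps = Steps-opposite⁻ {T = CircuitStep P} {y = points path}
                       (proj₂ (proj₂ (proj₂ (reversible (length path) (points path) (path-walk path a-vertex w-vertex)))))
    back-step : CircuitStep P target x
    back-step = Steps-suffix a⇝x (step ◅ x′⇝w) reversed-steps zero

  reversible⇒vertex-walks : AllWalksReversible P → AllWalksVertexWalks P
  reversible⇒vertex-walks reversible k y walk@(y₀-vertex , _ , steps) = walk , vertex
    where
    yᵢ∈P : ∀ i → InP (y i)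
    yᵢ∈P = walk-InP {k} {y} walk
    vertex : ∀ i → IsVertex P (y i)
    vertex i = vertex-unless-escapable {x = y i} (yᵢ∈P i) λ e x+e∈P x-e∈P e≢0 → (do
      esc ← escape {x = y i} y₀-vertex (yᵢ∈P i) x+e∈P x-e∈P e≢0
      (w , w-vertex , x′⇝w) ← reach-vertex y₀-vertex (Escape.target-InP esc)
      return (escape-irreversible reversible y₀-vertex w-vertex (prefix {y = y} steps i) esc x′⇝w)) id

  vertex-walks⇒reversible : AllWalksVertexWalks P → AllWalksReversible P
  vertex-walks⇒reversible vertex-walks k y walk@(y₀-vertex , yₖ-vertex , steps) =
    walk , yₖ-vertex , subst (IsVertex P ∘ y) (sym (opposite-fromℕ k)) y₀-vertex ,
    Steps-opposite {T = CircuitStep P} {y = y} reversed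
    where
    vertex = proj₂ (vertex-walks k y walk)
    reversed : Steps (flip (CircuitStep P)) k y
    reversed i = reverse-step {x = y (inject₁ i)} {y = y (suc i)}
                              (vertex (inject₁ i)) (proj₁ (vertex (suc i))) (steps i)

theorem2 : ∀ (n : ℕ) (P : Polyhedron n) → AllWalksReversible P ⇔ AllWalksVertexWalks P
theorem2 n P = mk⇔ reversible⇒vertex-walks vertex-walks⇒reversible
  where open Polyhedral P
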